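{- Let $T$ and $k$ be positive integers and let $w=\lceil T/k\rceil$. Consider a time-bucketed balance record structure $\mathcal{B}$ (as defined in the context) with these parameters, initially empty, and let an arbitrary finite sequence of operations (Deposit, Consume, Transfer, Prune, in any order, with arbitrary positive amounts, and where $\mathcal{B}$ may play the role of either sender or recipient in transfers) be applied to it at nondecreasing integer times. Then at all times the number of records satisfies $|\mathcal{B}|\le k+1$.
   Context: Times are nonnegative integers (seconds). A balance record structure is a finite list $\mathcal{B}=[(a_1,e_1),\dots,(a_n,e_n)]$ of pairs (amount $a_i\ge 0$, expiration timestamp $e_i$), kept sorted with $e_1<e_2<\dots<e_n$; $|\mathcal{B}|=n$ is the number of records. Fix a TTL $T$ and bucket width $w=\lceil T/k\rceil$, and define $\mathrm{BucketedExpiry}(t)=\lceil (t+T)/w\rceil\cdot w$. All structures in the system use the same $T$ and $w$. The operations, performed at current time $t_{\mathrm{now}}$, are: - Prune$(\mathcal{B},t_{\mathrm{now}})$: delete every record with $e_i\le t_{\mathrm{now}}$ or $a_i=0$, keeping the order of the remaining ones. - Insert$(\mathcal{B},a,e,t_{\mathrm{now}})$: first run Prune$(\mathcal{B},t_{\mathrm{now}})$; then scan records in order: if a record with $e_i=e$ is found, set $a_i\leftarrow a_i+a$ and stop (coalescing); if a record with $e_i>e$ is found first, insert $(a,e)$ immediately before it (shifting later records) and stop; if neither occurs, append $(a,e)$ at the end. - Deposit of amount $a>0$ at time $t$: Insert$(\mathcal{B},a,\mathrm{BucketedExpiry}(t),t)$. - Consume$(\mathcal{B},a,t_{\mathrm{now}})$: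 with remaining $r=a$ and an empty list $C$, scan records in order, skipping those with $e_i\le t_{\mathrm{now}}$; for each other record put $\delta=\min(r,a_i)$, set $a_i\leftarrow a_i-\delta$, append $(\delta,e_i)$ to $C$, and $r\leftarrow r-\delta$; if $r=0$ return success and $C$. If the scan ends with $r>0$, return failure. - Transfer of amount $a$ from $\mathcal{B}_s$ to $\mathcal{B}_r$ at time $t_{\mathrm{now}}$: run Consume$(\mathcal{B}_s,a,t_{\mathrm{now}})$; if it fails, stop; otherwise for each $(a_i,e_i)\in C$ run Insert$(\mathcal{B}_r,a_i,e_i,t_{\mathrm{now}})$ (the original expiration $e_i$ is kept, not re-bucketed). -}

module Defs where

open import Data.Nat using (ℕ; zero; suc; _+_; _*_; _∸_; _⊓_; _≤_; _<ᵇ_; _≤ᵇ_; _≡ᵇ_)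
open import Data.Nat.DivMod using (_/_)
open import Data.Bool using (Bool; true; false; if_then_else_; _∧_; not)
open import Data.Product using (_×_; _,_)
open import Data.List using (List; []; _∷_; [_]; filterᵇ; foldl; map)
open import Data.Maybe using (Maybe; just; nothing)
open import Data.Fin using (Fin; _≟_)
open import Relation.Nullary using (does)
open import Relation.Unary using (Pred)
open import Level using (0ℓ)

-- A record is a pair (amount , expiration timestamp).
Record : Set
Record = ℕ × ℕ

-- A balance record structure: list of records (kept sorted by expiration).
Balance : Set
Balance = List Record

-- Ceiling division ⌈ m / n ⌉ (defined as 0 when n = 0; never used with n = 0).
ceilDiv : ℕ → ℕ → ℕ
ceilDiv m zero    = 0
ceilDiv m (suc n) = (m + n) / suc n

width : ℕ → ℕ → ℕ
width T k = ceilDiv T k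

bucketedExpiry : ℕ → ℕ → ℕ → ℕ
bucketedExpiry T k t = ceilDiv (t + T) (width T k) * width T k

prune : ℕ → Balance → Balance
prune t = filterᵇ (λ { (a , e) → (t <ᵇ e) ∧ not (a ≡ᵇ 0) })

insertScan : ℕ → ℕ → Balance → Balance
insertScan a e [] = (a , e) ∷ []
insertScan a e ((a' , e') ∷ rest) =
  if e' ≡ᵇ e then (a' + a , e') ∷ rest
  else if e <ᵇ e' then (a , e) ∷ (a' , e') ∷ rest
  else (a' , e') ∷ insertScan a e rest

insert : ℕ → ℕ → ℕ → Balance → Balance
insert a e t B = insertScan a e (prune t B)

deposit : ℕ → ℕ → ℕ → ℕ → Balance → Balance
deposit T k a t B = insert a (bucketedExpiry T k t) t B

-- Consume scan: given remaining r, time t and records, returns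
-- (modified records, consumed list C, remaining amount at the end of the scan).
consumeScan : ℕ → ℕ → Balance → Balance × List Record × ℕ
consumeScan r t [] = [] , [] , r
consumeScan r t ((a , e) ∷ rest) =
  if e ≤ᵇ t
  then (let (B' , C , r') = consumeScan r t rest in ((a , e) ∷ B') , C , r')
  else (let δ = r ⊓ a in
        if (r ∸ δ) ≡ᵇ 0
        then (((a ∸ δ , e) ∷ rest) , ((δ , e) ∷ []) , 0)
        else (let (B' , C , r') = consumeScan (r ∸ δ) t rest in
              ((a ∸ δ , e) ∷ B') , ((δ , e) ∷ C) , r'))

-- Consume(B, a, t): the modified structure, and on success the list C.
-- (On failure, the in-place modifications made during the scan persist.)
consume : ℕ → ℕ → Balance → Balance × Maybe (List Record)
consume a t B with consumeScan a t B
... | B' , C , r = B' , (if r ≡ᵇ 0 then just C else nothing)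

State : ℕ → Set
State m = Fin m → Balance

emptyState : ∀ {m} → State m
emptyState _ = []

update : ∀ {m} → Fin m → Balance → State m → State m
update i B σ j = if does (i ≟ j) then B else σ j

data Op (m : ℕ) : Set where
  depositOp  : (i : Fin m) (a t : ℕ) → Op m
  consumeOp  : (i : Fin m) (a t : ℕ) → Op m
  transferOp : (s r : Fin m) (a t : ℕ) → Op m
  pruneOp    : (i : Fin m) (t : ℕ) → Op m

opTime : ∀ {m} → Op m → ℕ
opTime (depositOp _ _ t)    = t
opTime (consumeOp _ _ t)    = t
opTime (transferOp _ _ _ t) = t
opTime (pruneOp _ t)        = t

PositiveAmount : ∀ {m} → Pred (Op m) 0ℓ
PositiveAmount (depositOp _ a _)    = 1 ≤ a
PositiveAmount (consumeOp _ a _)    = 1 ≤ a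
PositiveAmount (transferOp _ _ a _) = 1 ≤ a
PositiveAmount (pruneOp _ _)        = Data.Nat._≤_ 0 0

insertAll : ℕ → List Record → Balance → Balance
insertAll t C B = foldl (λ B' ae → insert (Data.Product.proj₁ ae) (Data.Product.proj₂ ae) t B') B C

step : ∀ {m} → ℕ → ℕ → State m → Op m → State m
step T k σ (depositOp i a t) = update i (deposit T k a t (σ i)) σ
step T k σ (consumeOp i a t) with consume a t (σ i)
... | B' , _ = update i B' σ
step T k σ (transferOp s r a t) with consume a t (σ s)
... | B' , nothing = update s B' σ
... | B' , just C  =
  let σ₁ = update s B' σ in update r (insertAll t C (σ₁ r)) σ₁
step T k σ (pruneOp i t) = update i (prune t (σ i)) σ

run : ∀ {m} → ℕ → ℕ → List (Op m) → State m
run T k ops = foldl (step T k) emptyState ops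

-- Every expiration ever stored is a multiple of the bucket width w: deposits create such
-- expirations, and transfers only move expirations that already exist. At time t an expiration
-- created no later than t is below t + T + w ≤ t + (k + 1) w, so the live ones lie in the open
-- window (t , t + (k + 1) w), which holds at most k + 1 multiples of w. Insert prunes first, so
-- after it every record is live and distinct records have distinct expirations; Consume and a
-- failed Transfer never change the list of expirations; Prune only shrinks it.
module Submission where

open import Defs
open import Data.Nat using (ℕ; zero; suc; _+_; _*_; _∸_; _⊓_; _≤_; _<_; z≤n; s≤s; _<ᵇ_; _≤ᵇ_; _≡ᵇ_)
open import Data.Nat.Properties hiding (_≟_)
open import Data.Nat.DivMod using (_/_; _%_; m≡m%n+[m/n]*n; m%n<n; m/n*n≤m; m≥n⇒m/n>0)
open import Data.Nat.Divisibility using (_∣_; divides)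
open import Data.Fin using (Fin; _≟_)
open import Data.List using (List; []; _∷_; length; map; foldl)
open import Data.List.Properties using (length-map)
open import Data.List.Relation.Unary.All as All using (All; []; _∷_)
import Data.List.Relation.Unary.All.Properties as All
open import Data.List.Relation.Unary.AllPairs using (AllPairs; []; _∷_)
import Data.List.Relation.Unary.AllPairs.Properties as AllPairs
open import Data.List.Relation.Unary.Linked using (Linked; _∷_)
open import Data.Product using (_×_; _,_; proj₁; proj₂; ∃-syntax)
open import Data.Bool using (Bool; true; false; T; T?; not; _∧_)
open import Data.Bool.Properties using (T-∧)
open import Data.Maybe using (just; nothing)
open import Data.Empty using (⊥-elim)
open import Function using (_∘_; Equivalence)
open import Relation.Nullary using (does)
open import Relation.Binary.PropositionalEquality

expiries : Balance → List ℕ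
expiries = map proj₂

∣-<⇒+≤ : ∀ {w x y} → w ∣ x → w ∣ y → x < y → x + w ≤ y
∣-<⇒+≤ {w} (divides p refl) (divides q refl) p*w<q*w =
  subst (_≤ q * w) (+-comm w (p * w)) (*-monoˡ-≤ w (*-cancelʳ-< w p q p*w<q*w))

multiples-in-window-length : ∀ {w} → 0 < w → ∀ n t {es : List ℕ} → AllPairs _<_ es →
  All (w ∣_) es → All (t <_) es → All (_< t + n * w) es → length es ≤ n
multiples-in-window-length _ n t {[]} _ _ _ _ = z≤n
multiples-in-window-length _ zero t {e ∷ _} _ _ (t<e ∷ _) (e<t+0 ∷ _) =
  ⊥-elim (<-asym t<e (subst (e <_) (+-identityʳ t) e<t+0))
multiples-in-window-length {w} w>0 (suc n) t {e ∷ es}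
  (e<es ∷ sorted) (w∣e ∷ w∣es) (t<e ∷ _) (_ ∷ es<) =
  s≤s (multiples-in-window-length w>0 n (t + w) sorted w∣es
    (All.zipWith beyond-e (e<es , w∣es))
    (All.map (λ {y} → subst (y <_) (sym (+-assoc t w (n * w)))) es<))
  where
  beyond-e : ∀ {y} → e < y × w ∣ y → t + w < y
  beyond-e (e<y , w∣y) = <-≤-trans (+-monoˡ-< w t<e) (∣-<⇒+≤ w∣e w∣y e<y)

ceilDiv-lower : ∀ m n → 0 < n → m ≤ ceilDiv m n * n
ceilDiv-lower m (suc n) _ = +-cancelʳ-≤ n m (q * suc n) (begin
  m + n                             ≡⟨ m≡m%n+[m/n]*n (m + n) (suc n) ⟩
  (m + n) % suc n + q * suc n       ≤⟨ +-monoˡ-≤ (q * suc n) (<⇒≤pred (m%n<n (m + n) (suc n))) ⟩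
  n + q * suc n                     ≡⟨ +-comm n (q * suc n) ⟩
  q * suc n + n                     ∎)
  where
  open ≤-Reasoning
  q = (m + n) / suc n

ceilDiv-upper : ∀ m n → 0 < n → ceilDiv m n * n < m + n
ceilDiv-upper m (suc n) _ = ≤-<-trans (m/n*n≤m (m + n) (suc n)) (+-monoʳ-< m ≤-refl)

prune-live : ∀ t B → All (t <_) (expiries (prune t B))
prune-live t B = All.map⁺ (All.map (λ {x} → live {x}) (All.all-filter (T? ∘ keep) B))
  where
  -- the predicate filtered by prune, so that filter (T? ∘ keep) B is prune t B
  keep : Record → Bool
  keep (a , e) = (t <ᵇ e) ∧ not (a ≡ᵇ 0)
  live : ∀ {x} → T (keep x) → t < proj₂ x
  live {x} kept = <ᵇ⇒< t (proj₂ x) (proj₁ (Equivalence.to (T-∧ {t <ᵇ proj₂ x}) kept))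

prune-All : ∀ {P : ℕ → Set} t B → All P (expiries B) → All P (expiries (prune t B))
prune-All t B = All.map⁺ ∘ All.filter⁺ _ ∘ All.map⁻

prune-sorted : ∀ t B → AllPairs _<_ (expiries B) → AllPairs _<_ (expiries (prune t B))
prune-sorted t B = AllPairs.map⁺ ∘ AllPairs.filter⁺ _ ∘ AllPairs.map⁻

insertScan-All : ∀ {P : ℕ → Set} a e B → All P (expiries B) → P e →
  All P (expiries (insertScan a e B))
insertScan-All a e [] [] Pe = Pe ∷ []
insertScan-All a e ((a' , e') ∷ B) (Pe' ∷ PB) Pe with e' ≡ᵇ e | e <ᵇ e'
... | true  | _     = Pe' ∷ PB
... | false | true  = Pe ∷ Pe' ∷ PB
... | false | false = Pe' ∷ insertScan-All a e B PB Pe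

≢ᵇ∧≮ᵇ⇒> : ∀ e e' → (e' ≡ᵇ e) ≡ false → (e <ᵇ e') ≡ false → e' < e
≢ᵇ∧≮ᵇ⇒> e e' e'≢ᵇe e≮ᵇe' =
  ≤∧≢⇒< (≮⇒≥ (subst T e≮ᵇe' ∘ <⇒<ᵇ)) (subst T e'≢ᵇe ∘ ≡⇒≡ᵇ e' e)

insertScan-sorted : ∀ a e B → AllPairs _<_ (expiries B) → AllPairs _<_ (expiries (insertScan a e B))
insertScan-sorted a e [] [] = [] ∷ []
insertScan-sorted a e ((a' , e') ∷ B) (e'<B ∷ sorted) with e' ≡ᵇ e in e'≡ᵇe | e <ᵇ e' in e<ᵇe'
... | true  | _     = e'<B ∷ sorted
... | false | true  = (e<e' ∷ All.map (<-trans e<e') e'<B) ∷ e'<B ∷ sorted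
  where e<e' = <ᵇ⇒< e e' (subst T (sym e<ᵇe') _)
... | false | false =
  insertScan-All a e B e'<B (≢ᵇ∧≮ᵇ⇒> e e' e'≡ᵇe e<ᵇe') ∷ insertScan-sorted a e B sorted

≰ᵇ⇒> : ∀ e t → (e ≤ᵇ t) ≡ false → t < e
≰ᵇ⇒> e t e≰ᵇt = ≰⇒> (subst T e≰ᵇt ∘ ≤⇒≤ᵇ)

consumeScan-expiries : ∀ r t B → expiries (proj₁ (consumeScan r t B)) ≡ expiries B
consumeScan-expiries r t [] = refl
consumeScan-expiries r t ((a , e) ∷ B) with e ≤ᵇ t | (r ∸ (r ⊓ a)) ≡ᵇ 0
... | true  | _     = cong (e ∷_) (consumeScan-expiries r t B)
... | false | true  = refl
... | false | false = cong (e ∷_) (consumeScan-expiries (r ∸ (r ⊓ a)) t B)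

consumeScan-consumed : ∀ {P : ℕ → Set} r t B → All P (expiries B) →
  All (λ e → t < e × P e) (expiries (proj₁ (proj₂ (consumeScan r t B))))
consumeScan-consumed r t [] [] = []
consumeScan-consumed r t ((a , e) ∷ B) (Pe ∷ PB) with e ≤ᵇ t in e≤ᵇt | (r ∸ (r ⊓ a)) ≡ᵇ 0
... | true  | _     = consumeScan-consumed r t B PB
... | false | true  = (≰ᵇ⇒> e t e≤ᵇt , Pe) ∷ []
... | false | false = (≰ᵇ⇒> e t e≤ᵇt , Pe) ∷ consumeScan-consumed (r ∸ (r ⊓ a)) t B PB

consume-consumed : ∀ {P : ℕ → Set} a t B {C} → proj₂ (consume a t B) ≡ just C →
  All P (expiries B) → All (λ e → t < e × P e) (expiries C)
consume-consumed a t B _ PB with proj₂ (proj₂ (consumeScan a t B)) ≡ᵇ 0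
consume-consumed a t B refl PB | true = consumeScan-consumed a t B PB

update-All : ∀ {m} {P : Balance → Set} (i : Fin m) {B} (σ : State m) →
  P B → (∀ j → P (σ j)) → ∀ j → P (update i B σ j)
update-All i σ PB Pσ j with does (i ≟ j)
... | true  = PB
... | false = Pσ j

width>0 : ∀ T k → 0 < T → 0 < k → 0 < width T k
width>0 T (suc k) T>0 _ = m≥n⇒m/n>0 (+-monoˡ-≤ k T>0)

module BucketedBalances (T k : ℕ) (T>0 : 0 < T) (k>0 : 0 < k) where

  w : ℕ
  w = width T k

  w>0 : 0 < w
  w>0 = width>0 T k T>0 k>0

  Bucketed : ℕ → ℕ → Set
  Bucketed τ e = w ∣ e × e < τ + T + w

  Bucketed-mono : ∀ {τ t e} → τ ≤ t → Bucketed τ e → Bucketed t e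
  Bucketed-mono τ≤t (w∣e , e<) = w∣e , <-≤-trans e< (+-monoˡ-≤ w (+-monoˡ-≤ T τ≤t))

  bucketedExpiry-live : ∀ t → t < bucketedExpiry T k t
  bucketedExpiry-live t = <-≤-trans (m<m+n t T>0) (ceilDiv-lower (t + T) w w>0)

  bucketedExpiry-bucketed : ∀ t → Bucketed t (bucketedExpiry T k t)
  bucketedExpiry-bucketed t =
    divides (ceilDiv (t + T) w) refl , ceilDiv-upper (t + T) w w>0

  Bucketed⇒in-window : ∀ {t e} → Bucketed t e → e < t + suc k * w
  Bucketed⇒in-window {t} (_ , e<) = <-≤-trans e< (begin
    t + T + w         ≡⟨ +-assoc t T w ⟩
    t + (T + w)       ≤⟨ +-monoʳ-≤ t (+-monoˡ-≤ w (ceilDiv-lower T k k>0)) ⟩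
    t + (w * k + w)   ≡⟨ cong (t +_) (trans (+-comm (w * k) w) (cong (w +_) (*-comm w k))) ⟩
    t + suc k * w     ∎)
    where open ≤-Reasoning

  live-length : ∀ {t es} → AllPairs _<_ es → All (Bucketed t) es → All (t <_) es →
    length es ≤ suc k
  live-length {t} sorted bucketed live =
    multiples-in-window-length w>0 (suc k) t sorted
      (All.map proj₁ bucketed) live (All.map Bucketed⇒in-window bucketed)

  record Admissible (τ : ℕ) (es : List ℕ) : Set where
    field
      sorted   : AllPairs _<_ es
      bucketed : All (Bucketed τ) es
      bounded  : length es ≤ suc k

  open Admissible

  Admissible-mono : ∀ {τ t es} → τ ≤ t → Admissible τ es → Admissible t es
  Admissible-mono τ≤t adm = record
    { sorted = sorted adm ; bucketed = All.map (Bucketed-mono τ≤t) (bucketed adm) ; bounded = bounded adm }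

  prune-admissible : ∀ {t} B → Admissible t (expiries B) → Admissible t (expiries (prune t B))
  prune-admissible {t} B adm = record
    { sorted   = sorted′
    ; bucketed = bucketed′
    ; bounded  = live-length sorted′ bucketed′ (prune-live t B)
    }
    where
    sorted′ : AllPairs _<_ (expiries (prune t B))
    sorted′ = prune-sorted t B (sorted adm)
    bucketed′ : All (Bucketed t) (expiries (prune t B))
    bucketed′ = prune-All t B (bucketed adm)

  insert-admissible : ∀ {t e} a B → t < e → Bucketed t e →
    Admissible t (expiries B) → Admissible t (expiries (insert a e t B))
  insert-admissible {t} {e} a B t<e e-bucketed adm = record
    { sorted   = sorted′
    ; bucketed = bucketed′
    ; bounded  = live-length sorted′ bucketed′ (insertScan-All a e (prune t B) (prune-live t B) t<e)
    }
    where
    pruned : Admissible t (expiries (prune t B))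
    pruned = prune-admissible B adm
    sorted′ : AllPairs _<_ (expiries (insert a e t B))
    sorted′ = insertScan-sorted a e (prune t B) (sorted pruned)
    bucketed′ : All (Bucketed t) (expiries (insert a e t B))
    bucketed′ = insertScan-All a e (prune t B) (bucketed pruned) e-bucketed

  insertAll-admissible : ∀ {t} C B → All (λ e → t < e × Bucketed t e) (expiries C) →
    Admissible t (expiries B) → Admissible t (expiries (insertAll t C B))
  insertAll-admissible [] B [] adm = adm
  insertAll-admissible ((a , e) ∷ C) B ((t<e , e-bucketed) ∷ C-ok) adm =
    insertAll-admissible C (insert a e _ B) C-ok (insert-admissible a B t<e e-bucketed adm)

  consumeScan-admissible : ∀ {t} r B → Admissible t (expiries B) →
    Admissible t (expiries (proj₁ (consumeScan r t B)))
  consumeScan-admissible {t} r B = subst (Admissible t) (sym (consumeScan-expiries r t B))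

  consume-admissible : ∀ {t} a B {B′ M} → consume a t B ≡ (B′ , M) →
    Admissible t (expiries B) → Admissible t (expiries B′)
  consume-admissible a B refl = consumeScan-admissible a B

  Admissibleˢ : ∀ {m} → ℕ → State m → Set
  Admissibleˢ τ σ = ∀ j → Admissible τ (expiries (σ j))

  empty-admissible : ∀ {m τ} → Admissibleˢ τ (emptyState {m})
  empty-admissible _ = record { sorted = [] ; bucketed = [] ; bounded = z≤n }

  update-admissible : ∀ {m t} (i : Fin m) {B} (σ : State m) →
    Admissible t (expiries B) → Admissibleˢ t σ → Admissibleˢ t (update i B σ)
  update-admissible {t = t} = update-All {P = Admissible t ∘ expiries}

  step-admissible : ∀ {m} (σ : State m) op →
    Admissibleˢ (opTime op) σ → Admissibleˢ (opTime op) (step T k σ op)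
  step-admissible σ (depositOp i a t) adm = update-admissible i σ
    (insert-admissible a (σ i) (bucketedExpiry-live t) (bucketedExpiry-bucketed t) (adm i)) adm
  step-admissible σ (consumeOp i a t) adm =
    update-admissible i σ (consumeScan-admissible a (σ i) (adm i)) adm
  step-admissible σ (transferOp s r a t) adm with consume a t (σ s) in consumed
  ... | B′ , nothing = update-admissible s σ (consume-admissible a (σ s) consumed (adm s)) adm
  ... | B′ , just C = update-admissible r σ′
      (insertAll-admissible C (σ′ r)
        (consume-consumed a t (σ s) (cong proj₂ consumed) (bucketed (adm s))) (adm′ r))
      adm′
    where
    σ′ : State _
    σ′ = update s B′ σ
    adm′ : Admissibleˢ t σ′
    adm′ = update-admissible s σ (consume-admissible a (σ s) consumed (adm s)) adm
  step-admissible σ (pruneOp i t) adm = update-admissible i σ (prune-admissible (σ i) (adm i)) adm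

  run-admissible : ∀ {m τ} (σ : State m) ops → Linked _≤_ (τ ∷ map opTime ops) →
    Admissibleˢ τ σ → ∃[ τ′ ] Admissibleˢ τ′ (foldl (step T k) σ ops)
  run-admissible σ [] _ adm = _ , adm
  run-admissible σ (op ∷ ops) (τ≤t ∷ linked) adm =
    run-admissible (step T k σ op) ops linked
      (step-admissible σ op (λ j → Admissible-mono τ≤t (adm j)))

theorem1 : (T k : ℕ) → 0 < T → 0 < k → (m : ℕ) (ops : List (Op m)) →
    Linked _≤_ (map opTime ops) → All PositiveAmount ops →
    (i : Fin m) → length (run T k ops i) ≤ suc k
theorem1 T k T>0 k>0 m [] _ _ i = z≤n
theorem1 T k T>0 k>0 m (op ∷ ops) linked _ i =
  subst (_≤ suc k) (length-map proj₂ (run T k (op ∷ ops) i)) (Admissible.bounded (adm i))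
  where
  open BucketedBalances T k T>0 k>0
  adm : Admissibleˢ _ (run T k (op ∷ ops))
  adm = proj₂ (run-admissible emptyState (op ∷ ops) (≤-refl ∷ linked) empty-admissible)
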